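{- Let $p>2$ be a prime and $n\geq 1$. The fan $H_{p,pn-1}$ (in characteristic $p$) has: (1) $\binom{p}{3}n^3$ facets of type I; (2) $pn^2\binom{n}{2}\binom{p-1}{2}$ facets of type II; (3) $\binom{p}{2}\binom{n}{2}^2$ facets of type III. Consequently, for fixed $p$ the number of facets of $H_{p,m}$ is $\mathcal{O}(m^4)$.
   Context: $\mathbb{K}$ is an algebraically closed field with a nontrivial valuation $v:\mathbb{K}^*\to\mathbb{T}$, $\mathbb{Q}\subseteq\mathbb{T}\subseteq\mathbb{R}$; characteristic $p$ means both $\mathbb{K}$ and its residue field have characteristic $p$. Tropical polynomials of degree $m$, $f=\bigoplus_{r=0}^ma_rx^r$, are identified with $(a_0,\ldots,a_m)\in\mathbb{R}^{m+1}$. $H_{p,m}\subseteq\mathbb{R}^{m+1}$ is the (closure of the) set of $f$ having $0$ as tropical double root in characteristic $p$ (there are $F=\sum A_rX^r\in\mathbb{K}[X]$ with $v(A_r)=a_r$ and $B\in\mathbb{K}^*$, $v(B)=0$, a multiple root of $F$); it is a polyhedral fan of codimension 2, whose facets (maximal cells) are: type I $\{i,j,k\}$: minimum of the $a_r$ attained at $i,j,k$ with pairwise distinct residues mod $p$; type II $[\{i,j\},\{k,l\}]$: minimum attained at $i\neq j$ with $i\equiv j$, and after deleting all monomials $r\equiv i \pmod p$ the minimum is attained at $k,l$ with $k\not\equiv l$; type III $\{\{i,j\},\{k,l\}\}$: same as type II but with $k\equiv l$; the type III cells $\{\{i,j\},\{k,l\}\}$ and $\{\{k,l\},\{i,j\}\}$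 are the same facet. -}

module Defs where

open import Data.Nat using (ℕ; _≤_; _<_; ∣_-_∣)
open import Data.Nat.Divisibility using (_∣_)
open import Relation.Nullary using (¬_)
open import Data.Sum using (_⊎_)

_≡_[mod_] : ℕ → ℕ → ℕ → Set
a ≡ b [mod p ] = p ∣ ∣ a - b ∣

-- Monomial indices of a degree-m tropical polynomial are 0,…,m.
-- A finite set of indices is represented by its strictly increasing listing.

record FacetI (p m : ℕ) : Set where
  constructor typeI
  field
    i j k : ℕ
    .i<j : i < j
    .j<k : j < k
    .k≤m : k ≤ m
    .ij  : ¬ (i ≡ j [mod p ])
    .ik  : ¬ (i ≡ k [mod p ])
    .jk  : ¬ (j ≡ k [mod p ])

-- Type II facet [{i,j},{k,l}]: i≠j, i≡j; k≠l, k≢l, and k,l ≢ i (mod p)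
-- (k,l are among the monomials left after deleting those ≡ i mod p).
record FacetII (p m : ℕ) : Set where
  constructor typeII
  field
    i j k l : ℕ
    .i<j : i < j
    .j≤m : j ≤ m
    .k<l : k < l
    .l≤m : l ≤ m
    .ij  : i ≡ j [mod p ]
    .kl  : ¬ (k ≡ l [mod p ])
    .ki  : ¬ (k ≡ i [mod p ])
    .li  : ¬ (l ≡ i [mod p ])

-- Since {{i,j},{k,l}} = {{k,l},{i,j}}, we use the
-- canonical representative with i < k (the two pairs are disjoint).
record FacetIII (p m : ℕ) : Set where
  constructor typeIII
  field
    i j k l : ℕ
    .i<j : i < j
    .j≤m : j ≤ m
    .k<l : k < l
    .l≤m : l ≤ m
    .i<k : i < k
    .ij  : i ≡ j [mod p ]
    .kl  : k ≡ l [mod p ]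
    .ki  : ¬ (k ≡ i [mod p ])

Facet : ℕ → ℕ → Set
Facet p m = FacetI p m ⊎ (FacetII p m ⊎ FacetIII p m)

module Submission where

-- The monomial indices 0,…,pn-1 are in bijection with pairs (r, q), r < p,
-- q < n, via x = r + q·p; two indices are congruent mod p iff their
-- residues r agree.  A facet is a small set of indices, listed increasingly;
-- the counting argument lists the same set by increasing residue instead,
-- after which the residues and the quotients become independent choices:
--   type I   : 3 distinct residues, and a quotient for each  → C(p,3)·n³;
--   type II  : the residue a of the congruent pair and its two quotients,
--              then 2 residues ≠ a (i.e. a 2-subset of p-1 residues) and a
--              quotient for each                          → p·C(n,2)·C(p-1,2)·n²;
--   type III : 2 residues and a pair of quotients for each → C(p,2)·C(n,2)².  The bijections hold for all p, n ≥ 1.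

open import Defs
open import Data.Nat
  using (ℕ; zero; suc; _+_; _*_; _^_; _∸_; _≤_; _<_; s≤s; z<s; _<?_; _≟_;
         pred; NonZero; s≤s⁻¹; >-nonZero; ∣_-_∣)
open import Data.Nat.Properties
open import Data.Nat.DivMod
  using (_%_; _/_; m≡m%n+[m/n]*n; [m+kn]%n≡m%n; m<n⇒m%n≡m; +-distrib-/-∣ʳ; m<n⇒m/n≡0;
         m*n/n≡m; m%n<n; m<n*o⇒m/o<n; %-remove-+ʳ)
open import Data.Nat.Divisibility using (_∣_; divides; _∣?_)
open import Data.Nat.Primality using (Prime)
open import Data.Nat.Combinatorics using (_C_; nCk+nC[k+1]≡[n+1]C[k+1]; nC1≡n)
open import Data.Nat.Tactic.RingSolver using (solve-∀)
open import Data.Fin using (Fin; toℕ; fromℕ<)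
open import Data.Fin.Properties using (toℕ<n; toℕ-fromℕ<; fromℕ<-toℕ; +↔⊎; *↔×; 1↔⊤; injective⇒≤)
open import Data.Product using (_×_; ∃; Σ; _,_; proj₁; proj₂; swap)
open import Data.Product.Function.NonDependent.Propositional using (_×-↔_)
open import Data.Product.Function.Dependent.Propositional using (Σ-↔)
open import Data.Sum using (_⊎_; inj₁; inj₂)
open import Data.Sum.Function.Propositional using (_⊎-↔_)
open import Data.Unit using (⊤; tt)
open import Data.Empty using (⊥-elim; ⊥-elim-irr)
open import Function using (_∘_; id)
open import Function.Bundles using (_↔_; mk↔ₛ′; Inverse; Injection)
open import Function.Properties.Inverse using (↔⇒↣)
open import Function.Construct.Composition using (_↔-∘_)
open import Function.Related.Propositional using (module EquationalReasoning)
open import Function.Construct.Identity using (↔-id)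
open import Function.Construct.Symmetry using (↔-sym)
open import Relation.Nullary using (¬_; Dec; yes; no)
open import Relation.Nullary.Decidable using (recompute; _×-dec_)
open import Relation.Binary.PropositionalEquality

recompute< : ∀ {x y} → .(x < y) → x < y
recompute< {x} {y} = recompute (x <? y)

_,≡_ : ∀ {A B : Set} {a a′ : A} {b b′ : B} → a ≡ a′ → b ≡ b′ → (a , b) ≡ (a′ , b′)
_,≡_ = cong₂ _,_
infixr 4 _,≡_

≮∧≢⇒> : ∀ {a b} → ¬ (a < b) → a ≢ b → b < a
≮∧≢⇒> a≮b a≢b = ≤∧≢⇒< (≮⇒≥ a≮b) (≢-sym a≢b)

record Below (M : ℕ) : Set where
  constructor below
  field
    value : ℕ
    .bounded : value < M

below-≡ : ∀ {M x y} .{x<M : x < M} .{y<M : y < M} → x ≡ y → below x x<M ≡ below y y<M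
below-≡ refl = refl

Fin↔Below : ∀ M → Fin M ↔ Below M
Fin↔Below M = mk↔ₛ′ (λ i → below (toℕ i) (toℕ<n i)) from
  (λ { (below v v<M) → below-≡ (toℕ-fromℕ< (recompute< v<M)) })
  (λ i → fromℕ<-toℕ i (toℕ<n i))
  where
  from : Below M → Fin M
  from (below v v<M) = fromℕ< (recompute< v<M)

_⊕_ : ∀ {a b} {A B : Set} → Fin a ↔ A → Fin b ↔ B → Fin (a + b) ↔ (A ⊎ B)
f ⊕ g = (f ⊎-↔ g) ↔-∘ +↔⊎
infixr 6 _⊕_

_⊗_ : ∀ {a b} {A B : Set} → Fin a ↔ A → Fin b ↔ B → Fin (a * b) ↔ (A × B)
f ⊗ g = (f ×-↔ g) ↔-∘ *↔×
infixr 7 _⊗_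

Tuple : Set → ℕ → Set
Tuple A zero = ⊤
Tuple A (suc k) = A × Tuple A k

Fin^↔Tuple : ∀ {a} {A : Set} → Fin a ↔ A → ∀ k → Fin (a ^ k) ↔ Tuple A k
Fin^↔Tuple f zero = 1↔⊤
Fin^↔Tuple f (suc k) = f ⊗ Fin^↔Tuple f k

record Subset2 (M : ℕ) : Set where
  constructor subset2
  field
    a b : ℕ
    .a<b : a < b
    .b<M : b < M

record Subset3 (M : ℕ) : Set where
  constructor subset3
  field
    a b c : ℕ
    .a<b : a < b
    .b<c : b < c
    .c<M : c < M

subset2-≡ : ∀ {M a b a′ b′} .{p q p′ q′} → a ≡ a′ → b ≡ b′ →
  subset2 {M} a b p q ≡ subset2 a′ b′ p′ q′
subset2-≡ refl refl = refl

subset3-≡ : ∀ {M a b c a′ b′ c′} .{p q r p′ q′ r′} → a ≡ a′ → b ≡ b′ → c ≡ c′ →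
  subset3 {M} a b c p q r ≡ subset3 a′ b′ c′ p′ q′ r′
subset3-≡ refl refl refl = refl

top : ∀ {x M} → .(x < suc M) → ¬ (x < M) → x ≡ M
top x<1+M x≮M = ≤-antisym (s≤s⁻¹ (recompute< x<1+M)) (≮⇒≥ x≮M)

-- Pascal's rule for pairs: a 2-subset of {0,…,M} either avoids M or is {a, M}.
subset2-split : ∀ M → Subset2 (suc M) ↔ (Subset2 M ⊎ Below M)
subset2-split M = mk↔ₛ′ to from to∘from from∘to
  where
  to : Subset2 (suc M) → Subset2 M ⊎ Below M
  to (subset2 a b a<b b≤M) with b <? M
  ... | yes b<M = inj₁ (subset2 a b a<b b<M)
  ... | no _    = inj₂ (below a (<-≤-trans a<b (s≤s⁻¹ b≤M)))
  from : Subset2 M ⊎ Below M → Subset2 (suc M)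
  from (inj₁ (subset2 a b a<b b<M)) = subset2 a b a<b (m<n⇒m<1+n b<M)
  from (inj₂ (below a a<M))         = subset2 a M a<M ≤-refl
  to∘from : ∀ y → to (from y) ≡ y
  to∘from (inj₁ (subset2 a b a<b b<M)) with b <? M
  ... | yes _  = refl
  ... | no b≮M = ⊥-elim-irr (b≮M b<M)
  to∘from (inj₂ (below a a<M)) with M <? M
  ... | yes M<M = ⊥-elim (<-irrefl refl M<M)
  ... | no _    = refl
  from∘to : ∀ x → from (to x) ≡ x
  from∘to (subset2 a b a<b b≤M) with b <? M
  ... | yes _  = refl
  ... | no b≮M = subset2-≡ refl (sym (top b≤M b≮M))

-- Pascal's rule for triples: a 3-subset of {0,…,M} either avoids M or is
-- {a, b, M} with {a, b} a 2-subset of {0,…,M-1}.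
subset3-split : ∀ M → Subset3 (suc M) ↔ (Subset3 M ⊎ Subset2 M)
subset3-split M = mk↔ₛ′ to from to∘from from∘to
  where
  to : Subset3 (suc M) → Subset3 M ⊎ Subset2 M
  to (subset3 a b c a<b b<c c≤M) with c <? M
  ... | yes c<M = inj₁ (subset3 a b c a<b b<c c<M)
  ... | no _    = inj₂ (subset2 a b a<b (<-≤-trans b<c (s≤s⁻¹ c≤M)))
  from : Subset3 M ⊎ Subset2 M → Subset3 (suc M)
  from (inj₁ (subset3 a b c a<b b<c c<M)) = subset3 a b c a<b b<c (m<n⇒m<1+n c<M)
  from (inj₂ (subset2 a b a<b b<M))       = subset3 a b M a<b b<M ≤-refl
  to∘from : ∀ y → to (from y) ≡ y
  to∘from (inj₁ (subset3 a b c a<b b<c c<M)) with c <? M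
  ... | yes _  = refl
  ... | no c≮M = ⊥-elim-irr (c≮M c<M)
  to∘from (inj₂ (subset2 a b a<b b<M)) with M <? M
  ... | yes M<M = ⊥-elim (<-irrefl refl M<M)
  ... | no _    = refl
  from∘to : ∀ x → from (to x) ≡ x
  from∘to (subset3 a b c a<b b<c c≤M) with c <? M
  ... | yes _  = refl
  ... | no c≮M = subset3-≡ refl refl (sym (top c≤M c≮M))

Fin0↔Subset2 : Fin 0 ↔ Subset2 0
Fin0↔Subset2 = mk↔ₛ′ (λ ()) (λ { (subset2 _ _ _ b<0) → ⊥-elim-irr (n≮0 b<0) })
  (λ { (subset2 _ _ _ b<0) → ⊥-elim-irr (n≮0 b<0) }) (λ ())

Fin0↔Subset3 : Fin 0 ↔ Subset3 0
Fin0↔Subset3 = mk↔ₛ′ (λ ()) (λ { (subset3 _ _ _ _ _ c<0) → ⊥-elim-irr (n≮0 c<0) })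
  (λ { (subset3 _ _ _ _ _ c<0) → ⊥-elim-irr (n≮0 c<0) }) (λ ())

pascal2 : ∀ M → suc M C 2 ≡ M C 2 + M
pascal2 M = begin
  suc M C 2     ≡⟨ nCk+nC[k+1]≡[n+1]C[k+1] M 1 ⟨
  M C 1 + M C 2 ≡⟨ cong (_+ M C 2) (nC1≡n M) ⟩
  M + M C 2     ≡⟨ +-comm M (M C 2) ⟩
  M C 2 + M     ∎
  where open ≡-Reasoning

pascal3 : ∀ M → suc M C 3 ≡ M C 3 + M C 2
pascal3 M = trans (sym (nCk+nC[k+1]≡[n+1]C[k+1] M 2)) (+-comm (M C 2) (M C 3))

count2 : ∀ M → Fin (M C 2) ↔ Subset2 M
count2 zero    = Fin0↔Subset2
count2 (suc M) = begin
  Fin (suc M C 2)         ≡⟨ cong Fin (pascal2 M) ⟩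
  Fin (M C 2 + M)         ↔⟨ count2 M ⊕ Fin↔Below M ⟩
  (Subset2 M ⊎ Below M)   ↔⟨ subset2-split M ⟨
  Subset2 (suc M)         ∎
  where open EquationalReasoning

count3 : ∀ M → Fin (M C 3) ↔ Subset3 M
count3 zero    = Fin0↔Subset3
count3 (suc M) = begin
  Fin (suc M C 3)               ≡⟨ cong Fin (pascal3 M) ⟩
  Fin (M C 3 + M C 2)           ↔⟨ count3 M ⊕ count2 M ⟩
  (Subset3 M ⊎ Subset2 M)       ↔⟨ subset3-split M ⟨
  Subset3 (suc M)               ∎
  where open EquationalReasoning

≡mod-sym : ∀ {p x y} → x ≡ y [mod p ] → y ≡ x [mod p ]
≡mod-sym {p} {x} {y} = subst (p ∣_) (∣-∣-comm x y)

module Digits (p : ℕ) {{_ : NonZero p}} where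

  res : ℕ → ℕ
  res x = x % p

  quo : ℕ → ℕ
  quo x = x / p

  enc : ℕ → ℕ → ℕ
  enc r q = r + q * p

  enc-res-quo : ∀ x → enc (res x) (quo x) ≡ x
  enc-res-quo x = sym (m≡m%n+[m/n]*n x p)

  res-enc : ∀ {r} q → .(r < p) → res (enc r q) ≡ r
  res-enc {r} q r<p = trans ([m+kn]%n≡m%n r q p) (m<n⇒m%n≡m (recompute< r<p))

  quo-enc : ∀ {r} q → .(r < p) → quo (enc r q) ≡ q
  quo-enc {r} q r<p = begin
    (r + q * p) / p       ≡⟨ +-distrib-/-∣ʳ r (divides q refl) ⟩
    r / p + q * p / p     ≡⟨ cong₂ _+_ (m<n⇒m/n≡0 (recompute< r<p)) (m*n/n≡m q p) ⟩
    q                     ∎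
    where open ≡-Reasoning

  res< : ∀ x → res x < p
  res< x = m%n<n x p

  quo< : ∀ {x} n → x < p * n → quo x < n
  quo< {x} n x<pn = m<n*o⇒m/o<n (subst (x <_) (*-comm p n) x<pn)

  enc< : ∀ {r q} n → r < p → q < n → enc r q < p * n
  enc< {r} {q} n r<p q<n = begin-strict
    r + q * p  <⟨ +-monoˡ-< (q * p) r<p ⟩
    suc q * p  ≤⟨ *-monoˡ-≤ p q<n ⟩
    n * p      ≡⟨ *-comm n p ⟩
    p * n      ∎
    where open ≤-Reasoning

  enc-mono : ∀ r {q q′} → q < q′ → enc r q < enc r q′
  enc-mono r q<q′ = +-monoʳ-< r (*-monoˡ-< p q<q′)

  quo-mono : ∀ {x y} → res x ≡ res y → x < y → quo x < quo y
  quo-mono {x} {y} rx≡ry x<y = *-cancelʳ-< p (quo x) (quo y) (+-cancelˡ-< (res y) (quo x * p) (quo y * p) (begin-strict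
    res y + quo x * p  ≡⟨ cong (_+ quo x * p) rx≡ry ⟨
    enc (res x) (quo x) ≡⟨ enc-res-quo x ⟩
    x                  <⟨ x<y ⟩
    y                  ≡⟨ enc-res-quo y ⟨
    res y + quo y * p  ∎))
    where open ≤-Reasoning

  res-enc-< : ∀ {a b} qa qb → a < b → .(b < p) → res (enc a qa) < res (enc b qb)
  res-enc-< qa qb a<b b<p = subst₂ _<_ (sym (res-enc qa (<-trans a<b b<p))) (sym (res-enc qb b<p)) a<b

  enc-≢ : ∀ {a b} qa qb → .(a < p) → .(b < p) → a ≢ b → enc a qa ≢ enc b qb
  enc-≢ qa qb a<p b<p a≢b e = a≢b (trans (sym (res-enc qa a<p)) (trans (cong res e) (res-enc qb b<p)))

  -- If x ≤ y then y = x + (y ∸ x), so p ∣ y ∸ x means equal residues, and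
  -- conversely equal residues make y ∸ x = (quo y ∸ quo x) · p.
  ∣∸⇒res≡ : ∀ {x y} → x ≤ y → p ∣ (y ∸ x) → res x ≡ res y
  ∣∸⇒res≡ {x} {y} x≤y p∣y∸x = sym (trans (cong res (sym (m+[n∸m]≡n x≤y))) (%-remove-+ʳ x p∣y∸x))

  res≡⇒∣∸ : ∀ {x y} → res x ≡ res y → p ∣ (y ∸ x)
  res≡⇒∣∸ {x} {y} rx≡ry = divides (quo y ∸ quo x) (begin
    y ∸ x                                      ≡⟨ cong₂ _∸_ (enc-res-quo y) (enc-res-quo x) ⟨
    (res y + quo y * p) ∸ (res x + quo x * p)  ≡⟨ cong (λ r → (res y + quo y * p) ∸ (r + quo x * p)) rx≡ry ⟩
    (res y + quo y * p) ∸ (res y + quo x * p)  ≡⟨ [m+n]∸[m+o]≡n∸o (res y) (quo y * p) (quo x * p) ⟩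
    quo y * p ∸ quo x * p                      ≡⟨ *-distribʳ-∸ p (quo y) (quo x) ⟨
    (quo y ∸ quo x) * p                        ∎)
    where open ≡-Reasoning

  ≡mod⇒res≡ : ∀ {x y} → .(x ≡ y [mod p ]) → res x ≡ res y
  ≡mod⇒res≡ {x} {y} x≡y with ≤-total x y | recompute (p ∣? ∣ x - y ∣) x≡y
  ... | inj₁ x≤y | p∣x-y = ∣∸⇒res≡ x≤y (subst (p ∣_) (m≤n⇒∣m-n∣≡n∸m x≤y) p∣x-y)
  ... | inj₂ y≤x | p∣x-y =
    sym (∣∸⇒res≡ y≤x (subst (p ∣_) (m≤n⇒∣m-n∣≡n∸m y≤x) (≡mod-sym {p} {x} {y} p∣x-y)))

  res≡⇒≡mod : ∀ {x y} → res x ≡ res y → x ≡ y [mod p ]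
  res≡⇒≡mod {x} {y} rx≡ry with ≤-total x y
  ... | inj₁ x≤y = subst (p ∣_) (sym (m≤n⇒∣m-n∣≡n∸m x≤y)) (res≡⇒∣∸ rx≡ry)
  ... | inj₂ y≤x =
    ≡mod-sym {p} {y} {x} (subst (p ∣_) (sym (m≤n⇒∣m-n∣≡n∸m y≤x)) (res≡⇒∣∸ (sym rx≡ry)))

  ≢mod⇒res≢ : ∀ {x y} → .(¬ (x ≡ y [mod p ])) → res x ≢ res y
  ≢mod⇒res≢ x≢y rx≡ry = ⊥-elim-irr (x≢y (res≡⇒≡mod rx≡ry))

  res≢⇒≢mod : ∀ {x y} → res x ≢ res y → ¬ (x ≡ y [mod p ])
  res≢⇒≢mod rx≢ry x≡y = rx≢ry (≡mod⇒res≡ x≡y)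

-- A set of two or three elements of A can be listed increasingly
-- for a key function; if a second key also takes distinct values on it, the
-- set can equally be listed increasingly for that key.  Sorting is a
-- permutation chosen by comparing keys, and sorting a permutation of a sorted
-- list gives the list back; this makes the two listings mutually inverse.
module Reorder {A : Set} where

  Pair Triple : Set
  Pair   = A × A
  Triple = A × A × A

  data Perm2 : Set where
    p12 p21 : Perm2

  data Perm3 : Set where
    p123 p132 p312 p213 p231 p321 : Perm3

  permute2 : Perm2 → Pair → Pair
  permute2 p12 (x , y) = x , y
  permute2 p21 (x , y) = y , x

  permute3 : Perm3 → Triple → Triple
  permute3 p123 (x , y , z) = x , y , z
  permute3 p132 (x , y , z) = x , z , y
  permute3 p312 (x , y , z) = z , x , y
  permute3 p213 (x , y , z) = y , x , z
  permute3 p231 (x , y , z) = y , z , x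
  permute3 p321 (x , y , z) = z , y , x

  Sorted2 : (A → ℕ) → Pair → Set
  Sorted2 k (x , y) = k x < k y

  Sorted3 : (A → ℕ) → Triple → Set
  Sorted3 k (x , y , z) = k x < k y × k y < k z

  Distinct2 : (A → ℕ) → Pair → Set
  Distinct2 k (x , y) = k x ≢ k y

  Distinct3 : (A → ℕ) → Triple → Set
  Distinct3 k (x , y , z) = k x ≢ k y × k y ≢ k z × k x ≢ k z

  All2 : (A → Set) → Pair → Set
  All2 P (x , y) = P x × P y

  All3 : (A → Set) → Triple → Set
  All3 P (x , y , z) = P x × P y × P z

  sorted⇒distinct2 : ∀ k t → Sorted2 k t → Distinct2 k t
  sorted⇒distinct2 k (x , y) = <⇒≢

  sorted⇒distinct3 : ∀ k t → Sorted3 k t → Distinct3 k t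
  sorted⇒distinct3 k (x , y , z) (x<y , y<z) = <⇒≢ x<y , <⇒≢ y<z , <⇒≢ (<-trans x<y y<z)

  sorted2? : ∀ k t → Dec (Sorted2 k t)
  sorted2? k (x , y) = k x <? k y

  sorted3? : ∀ k t → Dec (Sorted3 k t)
  sorted3? k (x , y , z) = (k x <? k y) ×-dec (k y <? k z)

  distinct2-permute : ∀ {k} π t → Distinct2 k t → Distinct2 k (permute2 π t)
  distinct2-permute p12 (x , y) d = d
  distinct2-permute p21 (x , y) d = ≢-sym d

  distinct3-permute : ∀ {k} π t → Distinct3 k t → Distinct3 k (permute3 π t)
  distinct3-permute p123 (x , y , z) (xy , yz , xz) = xy , yz , xz
  distinct3-permute p132 (x , y , z) (xy , yz , xz) = xz , ≢-sym yz , xy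
  distinct3-permute p312 (x , y , z) (xy , yz , xz) = ≢-sym xz , xy , ≢-sym yz
  distinct3-permute p213 (x , y , z) (xy , yz , xz) = ≢-sym xy , xz , yz
  distinct3-permute p231 (x , y , z) (xy , yz , xz) = yz , ≢-sym xz , ≢-sym xy
  distinct3-permute p321 (x , y , z) (xy , yz , xz) = ≢-sym yz , ≢-sym xy , ≢-sym xz

  all2-permute : ∀ {P} π t → All2 P t → All2 P (permute2 π t)
  all2-permute p12 (x , y) g = g
  all2-permute p21 (x , y) g = swap g

  all3-permute : ∀ {P} π t → All3 P t → All3 P (permute3 π t)
  all3-permute p123 (x , y , z) (gx , gy , gz) = gx , gy , gz
  all3-permute p132 (x , y , z) (gx , gy , gz) = gx , gz , gy
  all3-permute p312 (x , y , z) (gx , gy , gz) = gz , gx , gy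
  all3-permute p213 (x , y , z) (gx , gy , gz) = gy , gx , gz
  all3-permute p231 (x , y , z) (gx , gy , gz) = gy , gz , gx
  all3-permute p321 (x , y , z) (gx , gy , gz) = gz , gy , gx

  sorting2 : (A → ℕ) → Pair → Perm2
  sorting2 k (x , y) with k x <? k y
  ... | yes _ = p12
  ... | no _  = p21

  sorting3 : (A → ℕ) → Triple → Perm3
  sorting3 k (x , y , z) with k x <? k y | k y <? k z | k x <? k z
  ... | yes _ | yes _ | _     = p123
  ... | yes _ | no _  | yes _ = p132
  ... | yes _ | no _  | no _  = p312
  ... | no _  | yes _ | yes _ = p213
  ... | no _  | yes _ | no _  = p231
  ... | no _  | no _  | _     = p321

  sort2 : (A → ℕ) → Pair → Pair
  sort2 k t = permute2 (sorting2 k t) t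

  sort3 : (A → ℕ) → Triple → Triple
  sort3 k t = permute3 (sorting3 k t) t

  sort2-sorted : ∀ k t → Distinct2 k t → Sorted2 k (sort2 k t)
  sort2-sorted k (x , y) xy with k x <? k y
  ... | yes x<y = x<y
  ... | no x≮y  = ≮∧≢⇒> x≮y xy

  sort3-sorted : ∀ k t → Distinct3 k t → Sorted3 k (sort3 k t)
  sort3-sorted k (x , y , z) (xy , yz , xz) with k x <? k y | k y <? k z | k x <? k z
  ... | yes x<y | yes y<z | _       = x<y , y<z
  ... | yes x<y | no y≮z  | yes x<z = x<z , ≮∧≢⇒> y≮z yz
  ... | yes x<y | no _    | no x≮z  = ≮∧≢⇒> x≮z xz , x<y
  ... | no x≮y  | yes _   | yes x<z = ≮∧≢⇒> x≮y xy , x<z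
  ... | no _    | yes y<z | no x≮z  = y<z , ≮∧≢⇒> x≮z xz
  ... | no x≮y  | no y≮z  | _       = ≮∧≢⇒> y≮z yz , ≮∧≢⇒> x≮y xy

  sort2-permute : ∀ k t → Sorted2 k t → ∀ π → sort2 k (permute2 π t) ≡ t
  sort2-permute k (x , y) x<y p12 with k x <? k y
  ... | yes _  = refl
  ... | no x≮y = ⊥-elim (x≮y x<y)
  sort2-permute k (x , y) x<y p21 with k y <? k x
  ... | yes y<x = ⊥-elim (<-asym x<y y<x)
  ... | no _    = refl

  sort3-permute : ∀ k t → Sorted3 k t → ∀ π → sort3 k (permute3 π t) ≡ t
  sort3-permute k (u , v , w) (u<v , v<w) p123 with k u <? k v | k v <? k w
  ... | yes _  | yes _  = refl
  ... | no u≮v | _      = ⊥-elim (u≮v u<v)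
  ... | yes _  | no v≮w = ⊥-elim (v≮w v<w)
  sort3-permute k (u , v , w) (u<v , v<w) p132 with k u <? k w | k w <? k v | k u <? k v
  ... | yes _  | yes w<v | _      = ⊥-elim (<-asym v<w w<v)
  ... | yes _  | no _    | yes _  = refl
  ... | yes _  | no _    | no u≮v = ⊥-elim (u≮v u<v)
  ... | no u≮w | _       | _      = ⊥-elim (u≮w (<-trans u<v v<w))
  sort3-permute k (u , v , w) (u<v , v<w) p312 with k w <? k u | k u <? k v | k w <? k v
  ... | yes w<u | _      | _       = ⊥-elim (<-asym (<-trans u<v v<w) w<u)
  ... | no _    | yes _  | yes w<v = ⊥-elim (<-asym v<w w<v)
  ... | no _    | yes _  | no _    = refl
  ... | no _    | no u≮v | _       = ⊥-elim (u≮v u<v)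
  sort3-permute k (u , v , w) (u<v , v<w) p213 with k v <? k u | k u <? k w | k v <? k w
  ... | yes v<u | _      | _      = ⊥-elim (<-asym u<v v<u)
  ... | no _    | yes _  | yes _  = refl
  ... | no _    | yes _  | no v≮w = ⊥-elim (v≮w v<w)
  ... | no _    | no u≮w | _      = ⊥-elim (u≮w (<-trans u<v v<w))
  sort3-permute k (u , v , w) (u<v , v<w) p231 with k v <? k w | k w <? k u | k v <? k u
  ... | yes _  | yes w<u | _       = ⊥-elim (<-asym (<-trans u<v v<w) w<u)
  ... | yes _  | no _    | yes v<u = ⊥-elim (<-asym u<v v<u)
  ... | yes _  | no _    | no _    = refl
  ... | no v≮w | _       | _       = ⊥-elim (v≮w v<w)
  sort3-permute k (u , v , w) (u<v , v<w) p321 with k w <? k v | k v <? k u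
  ... | yes w<v | _       = ⊥-elim (<-asym v<w w<v)
  ... | no _    | yes v<u = ⊥-elim (<-asym u<v v<u)
  ... | no _    | no _    = refl

  record Inc2 (key tag : A → ℕ) (P : A → Set) : Set where
    constructor inc2
    field
      elems     : Pair
      .ordered  : Sorted2 key elems
      .distinct : Distinct2 tag elems
      .good     : All2 P elems

  record Inc3 (key tag : A → ℕ) (P : A → Set) : Set where
    constructor inc3
    field
      elems     : Triple
      .ordered  : Sorted3 key elems
      .distinct : Distinct3 tag elems
      .good     : All3 P elems

  inc2-≡ : ∀ {key tag P t t′} .{o d g o′ d′ g′} → t ≡ t′ →
    inc2 {key} {tag} {P} t o d g ≡ inc2 t′ o′ d′ g′
  inc2-≡ refl = refl

  inc3-≡ : ∀ {key tag P t t′} .{o d g o′ d′ g′} → t ≡ t′ →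
    inc3 {key} {tag} {P} t o d g ≡ inc3 t′ o′ d′ g′
  inc3-≡ refl = refl

  resort2 : ∀ key tag P → Inc2 key tag P ↔ Inc2 tag key P
  resort2 key tag P = mk↔ₛ′ (relist tag) (relist key) (relist-relist tag key) (relist-relist key tag)
    where
    relist : ∀ {k} k′ → Inc2 k k′ P → Inc2 k′ k P
    relist {k} k′ (inc2 t o d g) =
      inc2 (sort2 k′ t) (sort2-sorted k′ t d)
        (distinct2-permute {k} (sorting2 k′ t) t (sorted⇒distinct2 k t o)) (all2-permute {P} (sorting2 k′ t) t g)
    relist-relist : ∀ k k′ (x : Inc2 k k′ P) → relist k (relist k′ x) ≡ x
    relist-relist k k′ (inc2 t o d g) =
      inc2-≡ (sort2-permute k t (recompute (sorted2? k t) o) (sorting2 k′ t))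

  resort3 : ∀ key tag P → Inc3 key tag P ↔ Inc3 tag key P
  resort3 key tag P = mk↔ₛ′ (relist tag) (relist key) (relist-relist tag key) (relist-relist key tag)
    where
    relist : ∀ {k} k′ → Inc3 k k′ P → Inc3 k′ k P
    relist {k} k′ (inc3 t o d g) =
      inc3 (sort3 k′ t) (sort3-sorted k′ t d)
        (distinct3-permute {k} (sorting3 k′ t) t (sorted⇒distinct3 k t o)) (all3-permute {P} (sorting3 k′ t) t g)
    relist-relist : ∀ k k′ (x : Inc3 k k′ P) → relist k (relist k′ x) ≡ x
    relist-relist k k′ (inc3 t o d g) =
      inc3-≡ (sort3-permute k t (recompute (sorted3? k t) o) (sorting3 k′ t))

-- Removing one value a: `skip a` lists ℕ ∖ {a} increasingly and `unskip a`
-- inverts it there.  They identify the residues other than a with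
-- {0,…,p-2}, preserving the order.
skip : ℕ → ℕ → ℕ
skip a y with y <? a
... | yes _ = y
... | no _  = suc y

unskip : ℕ → ℕ → ℕ
unskip a x with x <? a
... | yes _ = x
... | no _  = pred x

skip≢ : ∀ a y → skip a y ≢ a
skip≢ a y with y <? a
... | yes y<a = <⇒≢ y<a
... | no y≮a  = λ 1+y≡a → y≮a (subst (y <_) 1+y≡a ≤-refl)

unskip-skip : ∀ a y → unskip a (skip a y) ≡ y
unskip-skip a y with y <? a
... | no y≮a with suc y <? a
...   | yes 1+y<a = ⊥-elim (y≮a (<-trans (n<1+n y) 1+y<a))
...   | no _      = refl
unskip-skip a y | yes y<a with y <? a
...   | yes _  = refl
...   | no y≮a = ⊥-elim (y≮a y<a)

skip-unskip : ∀ a x → .(x ≢ a) → skip a (unskip a x) ≡ x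
skip-unskip a x x≢a with x <? a
skip-unskip a x x≢a | yes x<a with x <? a
...   | yes _  = refl
...   | no x≮a = ⊥-elim (x≮a x<a)
skip-unskip a zero x≢a | no 0≮a = ⊥-elim-irr (x≢a (sym (n≤0⇒n≡0 (≮⇒≥ 0≮a))))
skip-unskip a (suc x) x≢a | no 1+x≮a with x <? a
...   | yes x<a = ⊥-elim-irr (x≢a (≤-antisym x<a (≮⇒≥ 1+x≮a)))
...   | no _    = refl

skip-mono : ∀ a {y z} → y < z → skip a y < skip a z
skip-mono a {y} {z} y<z with y <? a | z <? a
... | yes _   | yes _   = y<z
... | yes _   | no _    = m<n⇒m<1+n y<z
... | no y≮a  | yes z<a = ⊥-elim (y≮a (<-trans y<z z<a))
... | no _    | no _    = s≤s y<z

unskip-mono : ∀ a {x y} → x ≢ a → y ≢ a → x < y → unskip a x < unskip a y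
unskip-mono a {x} {y} x≢a y≢a x<y with x <? a | y <? a
... | yes _   | yes _   = x<y
... | yes x<a | no y≮a  = <-≤-trans x<a (<⇒≤pred (≮∧≢⇒> y≮a y≢a))
... | no x≮a  | yes y<a = ⊥-elim (x≮a (<-trans x<y y<a))
... | no x≮a  | no _    = pred-mono-< {{>-nonZero (<-≤-trans z<s (≮∧≢⇒> x≮a x≢a))}} x<y

skip< : ∀ {p} a {y} → y < pred p → skip a y < p
skip< {suc p} a {y} y<p with y <? a
... | yes _ = m<n⇒m<1+n y<p
... | no _  = s≤s y<p

unskip< : ∀ {p} a {x} → a < p → x < p → x ≢ a → unskip a x < pred p
unskip< {p} a {x} a<p x<p x≢a with x <? a
... | yes x<a = <-≤-trans x<a (<⇒≤pred a<p)
... | no x≮a  = pred-mono-< {{>-nonZero (<-≤-trans z<s (≮∧≢⇒> x≮a x≢a))}} x<p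

regroup : ∀ w x y z → w * x * y * z ≡ (w * y) * (z * x)
regroup = solve-∀

module Facets (p n : ℕ) {{_ : NonZero p}} {{_ : NonZero n}} where
  open Digits p
  open Reorder

  N : ℕ
  N = p * n

  instance
    N≢0 : NonZero N
    N≢0 = m*n≢0 p n

  Index : ℕ → Set
  Index x = x < N

  ≤deg⇒< : ∀ {x} → x ≤ pred N → x < N
  ≤deg⇒< = m≤pred[n]⇒suc[m]≤n

  typeI↔Inc3 : FacetI p (pred N) ↔ Inc3 id res Index
  typeI↔Inc3 = mk↔ₛ′ to from (λ _ → refl) (λ _ → refl)
    where
    to : FacetI p (pred N) → Inc3 id res Index
    to (typeI i j k i<j j<k k≤m ij ik jk) =
      inc3 (i , j , k) (i<j , j<k) (≢mod⇒res≢ ij , ≢mod⇒res≢ jk , ≢mod⇒res≢ ik)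
        (<-trans i<j (<-trans j<k (≤deg⇒< k≤m)) , <-trans j<k (≤deg⇒< k≤m) , ≤deg⇒< k≤m)
    from : Inc3 id res Index → FacetI p (pred N)
    from (inc3 (i , j , k) o d g) =
      typeI i j k (proj₁ o) (proj₂ o) (<⇒≤pred (proj₂ (proj₂ g)))
        (res≢⇒≢mod (proj₁ d)) (res≢⇒≢mod (proj₂ (proj₂ d))) (res≢⇒≢mod (proj₁ (proj₂ d)))

  digitsI : Inc3 res id Index ↔ (Subset3 p × Tuple (Below n) 3)
  digitsI = mk↔ₛ′ to from to∘from from∘to
    where
    to : Inc3 res id Index → Subset3 p × Tuple (Below n) 3
    to (inc3 (x , y , z) o _ g) =
      subset3 (res x) (res y) (res z) (proj₁ o) (proj₂ o) (res< z)
      , below (quo x) (quo< n (proj₁ g)) , below (quo y) (quo< n (proj₁ (proj₂ g)))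
      , below (quo z) (quo< n (proj₂ (proj₂ g))) , tt
    from : Subset3 p × Tuple (Below n) 3 → Inc3 res id Index
    from (subset3 a b c a<b b<c c<p , below qa qa<n , below qb qb<n , below qc qc<n , tt) =
      inc3 (enc a qa , enc b qb , enc c qc)
        (res-enc-< qa qb a<b (<-trans b<c c<p) , res-enc-< qb qc b<c c<p)
        ( enc-≢ qa qb (<-trans a<b (<-trans b<c c<p)) (<-trans b<c c<p) (<⇒≢ a<b)
        , enc-≢ qb qc (<-trans b<c c<p) c<p (<⇒≢ b<c)
        , enc-≢ qa qc (<-trans a<b (<-trans b<c c<p)) c<p (<⇒≢ (<-trans a<b b<c)))
        (enc< n (<-trans a<b (<-trans b<c c<p)) qa<n , enc< n (<-trans b<c c<p) qb<n , enc< n c<p qc<n)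
    to∘from : ∀ t → to (from t) ≡ t
    to∘from (subset3 a b c a<b b<c c<p , below qa _ , below qb _ , below qc _ , tt) =
      subset3-≡ (res-enc qa (<-trans a<b (<-trans b<c c<p))) (res-enc qb (<-trans b<c c<p)) (res-enc qc c<p)
      ,≡ below-≡ (quo-enc qa (<-trans a<b (<-trans b<c c<p))) ,≡ below-≡ (quo-enc qb (<-trans b<c c<p))
      ,≡ below-≡ (quo-enc qc c<p) ,≡ refl
    from∘to : ∀ f → from (to f) ≡ f
    from∘to (inc3 (x , y , z) _ _ _) = inc3-≡ (enc-res-quo x ,≡ enc-res-quo y ,≡ enc-res-quo z)

  countI : Fin ((p C 3) * n ^ 3) ↔ FacetI p (pred N)
  countI = begin
    Fin ((p C 3) * n ^ 3)              ↔⟨ count3 p ⊗ Fin^↔Tuple (Fin↔Below n) 3 ⟩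
    (Subset3 p × Tuple (Below n) 3)    ↔⟨ digitsI ⟨
    Inc3 res id Index                  ↔⟨ resort3 id res Index ⟨
    Inc3 id res Index                  ↔⟨ typeI↔Inc3 ⟨
    FacetI p (pred N)                  ∎
    where open EquationalReasoning

  -- A pair of congruent indices lo < hi: the shape of {i, j} in the facets
  -- of type II and of {i, j}, {k, l} in those of type III.
  record CongPair : Set where
    constructor cpair
    field
      lo hi     : ℕ
      .lo<hi    : lo < hi
      .hi<N     : hi < N
      .same-res : res lo ≡ res hi
  open CongPair

  cpair-≡ : ∀ {i j i′ j′} .{a b c a′ b′ c′} → i ≡ i′ → j ≡ j′ →
    cpair i j a b c ≡ cpair i′ j′ a′ b′ c′
  cpair-≡ refl refl = refl

  congPair↔ : CongPair ↔ (Below p × Subset2 n)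
  congPair↔ = mk↔ₛ′ to from to∘from from∘to
    where
    to : CongPair → Below p × Subset2 n
    to (cpair i j i<j j<N r) = below (res i) (res< i) , subset2 (quo i) (quo j) (quo-mono r i<j) (quo< n j<N)
    from : Below p × Subset2 n → CongPair
    from (below a a<p , subset2 x y x<y y<n) =
      cpair (enc a x) (enc a y) (enc-mono a x<y) (enc< n a<p y<n) (trans (res-enc x a<p) (sym (res-enc y a<p)))
    to∘from : ∀ c → to (from c) ≡ c
    to∘from (below a a<p , subset2 x y _ _) = below-≡ (res-enc x a<p) ,≡ subset2-≡ (quo-enc x a<p) (quo-enc y a<p)
    from∘to : ∀ c → from (to c) ≡ c
    from∘to (cpair i j _ _ r) =
      cpair-≡ (enc-res-quo i) (trans (cong (λ a → enc a (quo j)) (recompute (res i ≟ res j) r)) (enc-res-quo j))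

  typeIII↔Inc2 : FacetIII p (pred N) ↔ Inc2 lo (res ∘ lo) (λ _ → ⊤)
  typeIII↔Inc2 = mk↔ₛ′ to from (λ _ → refl) (λ _ → refl)
    where
    to : FacetIII p (pred N) → Inc2 lo (res ∘ lo) (λ _ → ⊤)
    to (typeIII i j k l i<j j≤m k<l l≤m i<k ij kl ki) =
      inc2 (cpair i j i<j (≤deg⇒< j≤m) (≡mod⇒res≡ ij) , cpair k l k<l (≤deg⇒< l≤m) (≡mod⇒res≡ kl))
        i<k (≢-sym (≢mod⇒res≢ ki)) (tt , tt)
    from : Inc2 lo (res ∘ lo) (λ _ → ⊤) → FacetIII p (pred N)
    from (inc2 (cpair i j i<j j<N ij , cpair k l k<l l<N kl) i<k ik _) =
      typeIII i j k l i<j (<⇒≤pred j<N) k<l (<⇒≤pred l<N) i<k (res≡⇒≡mod ij) (res≡⇒≡mod kl)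
        (res≢⇒≢mod (≢-sym ik))

  digitsIII : Inc2 (res ∘ lo) lo (λ _ → ⊤) ↔ (Subset2 p × Tuple (Subset2 n) 2)
  digitsIII = mk↔ₛ′ to from to∘from from∘to
    where
    open Inverse congPair↔ using ()
      renaming (to to shape; from to ofShape; strictlyInverseʳ to ofShape∘shape)
    to : Inc2 (res ∘ lo) lo (λ _ → ⊤) → Subset2 p × Tuple (Subset2 n) 2
    to (inc2 (c , d) o _ _) =
      subset2 (res (lo c)) (res (lo d)) o (res< (lo d)) , proj₂ (shape c) , proj₂ (shape d) , tt
    from : Subset2 p × Tuple (Subset2 n) 2 → Inc2 (res ∘ lo) lo (λ _ → ⊤)
    from (subset2 a b a<b b<p , subset2 x y x<y y<n , subset2 z w z<w w<n , tt) =
      inc2 (ofShape (below a (<-trans a<b b<p) , subset2 x y x<y y<n) , ofShape (below b b<p , subset2 z w z<w w<n))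
        (res-enc-< x z a<b b<p) (enc-≢ x z (<-trans a<b b<p) b<p (<⇒≢ a<b)) (tt , tt)
    to∘from : ∀ t → to (from t) ≡ t
    to∘from (subset2 a b a<b b<p , subset2 x y _ _ , subset2 z w _ _ , tt) =
      subset2-≡ (res-enc x (<-trans a<b b<p)) (res-enc z b<p)
      ,≡ subset2-≡ (quo-enc x (<-trans a<b b<p)) (quo-enc y (<-trans a<b b<p))
      ,≡ subset2-≡ (quo-enc z b<p) (quo-enc w b<p) ,≡ refl
    from∘to : ∀ f → from (to f) ≡ f
    from∘to (inc2 (c , d) _ _ _) = inc2-≡ (ofShape∘shape c ,≡ ofShape∘shape d)

  countIII : Fin ((p C 2) * (n C 2) ^ 2) ↔ FacetIII p (pred N)
  countIII = begin
    Fin ((p C 2) * (n C 2) ^ 2)          ↔⟨ count2 p ⊗ Fin^↔Tuple (count2 n) 2 ⟩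
    (Subset2 p × Tuple (Subset2 n) 2)    ↔⟨ digitsIII ⟨
    Inc2 (res ∘ lo) lo (λ _ → ⊤)         ↔⟨ resort2 lo (res ∘ lo) (λ _ → ⊤) ⟨
    Inc2 lo (res ∘ lo) (λ _ → ⊤)         ↔⟨ typeIII↔Inc2 ⟨
    FacetIII p (pred N)                  ∎
    where open EquationalReasoning

  Avoid : ℕ → ℕ → Set
  Avoid a x = x < N × res x ≢ a

  typeII↔Σ : FacetII p (pred N) ↔ Σ CongPair (λ c → Inc2 id res (Avoid (res (lo c))))
  typeII↔Σ = mk↔ₛ′ to from (λ _ → refl) (λ _ → refl)
    where
    to : FacetII p (pred N) → Σ CongPair (λ c → Inc2 id res (Avoid (res (lo c))))
    to (typeII i j k l i<j j≤m k<l l≤m ij kl ki li) =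
      cpair i j i<j (≤deg⇒< j≤m) (≡mod⇒res≡ ij)
      , inc2 (k , l) k<l (≢mod⇒res≢ kl)
          ((<-trans k<l (≤deg⇒< l≤m) , ≢mod⇒res≢ ki) , (≤deg⇒< l≤m , ≢mod⇒res≢ li))
    from : Σ CongPair (λ c → Inc2 id res (Avoid (res (lo c)))) → FacetII p (pred N)
    from (cpair i j i<j j<N ij , inc2 (k , l) k<l kl g) =
      typeII i j k l i<j (<⇒≤pred j<N) k<l (<⇒≤pred (proj₁ (proj₂ g))) (res≡⇒≡mod ij) (res≢⇒≢mod kl)
        (res≢⇒≢mod (proj₂ (proj₁ g))) (res≢⇒≢mod (proj₂ (proj₂ g)))

  digitsII : ∀ a → a < p → Inc2 res id (Avoid a) ↔ (Subset2 (pred p) × Tuple (Below n) 2)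
  digitsII a a<p = mk↔ₛ′ to from to∘from from∘to
    where
    to : Inc2 res id (Avoid a) → Subset2 (pred p) × Tuple (Below n) 2
    to (inc2 (x , y) o _ g) =
      subset2 (unskip a (res x)) (unskip a (res y))
        (unskip-mono a (proj₂ (proj₁ g)) (proj₂ (proj₂ g)) o) (unskip< a a<p (res< y) (proj₂ (proj₂ g)))
      , below (quo x) (quo< n (proj₁ (proj₁ g))) , below (quo y) (quo< n (proj₁ (proj₂ g))) , tt
    avoids : ∀ {b} q → .(b < pred p) → res (enc (skip a b) q) ≢ a
    avoids {b} q b<p-1 e = skip≢ a b (trans (sym (res-enc q (skip< a b<p-1))) e)
    from : Subset2 (pred p) × Tuple (Below n) 2 → Inc2 res id (Avoid a)
    from (subset2 b c b<c c<p-1 , below qb qb<n , below qc qc<n , tt) =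
      inc2 (enc (skip a b) qb , enc (skip a c) qc)
        (res-enc-< qb qc (skip-mono a b<c) (skip< a c<p-1))
        (enc-≢ qb qc (skip< a (<-trans b<c c<p-1)) (skip< a c<p-1) (<⇒≢ (skip-mono a b<c)))
        ( (enc< n (skip< a (<-trans b<c c<p-1)) qb<n , avoids qb (<-trans b<c c<p-1))
        , (enc< n (skip< a c<p-1) qc<n , avoids qc c<p-1))
    to∘from : ∀ t → to (from t) ≡ t
    to∘from (subset2 b c b<c c<p-1 , below qb _ , below qc _ , tt) =
      subset2-≡ (trans (cong (unskip a) (res-enc qb (skip< a (<-trans b<c c<p-1)))) (unskip-skip a b))
                (trans (cong (unskip a) (res-enc qc (skip< a c<p-1))) (unskip-skip a c))
      ,≡ below-≡ (quo-enc qb (skip< a (<-trans b<c c<p-1))) ,≡ below-≡ (quo-enc qc (skip< a c<p-1)) ,≡ refl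
    decode : ∀ x → .(res x ≢ a) → enc (skip a (unskip a (res x))) (quo x) ≡ x
    decode x rx≢a = trans (cong (λ r → enc r (quo x)) (skip-unskip a (res x) rx≢a)) (enc-res-quo x)
    from∘to : ∀ f → from (to f) ≡ f
    from∘to (inc2 (x , y) _ _ g) = inc2-≡ (decode x (proj₂ (proj₁ g)) ,≡ decode y (proj₂ (proj₂ g)))

  -- The four factors of the type II count, grouped as the bijections produce them.
  regroupII : p * n ^ 2 * (n C 2) * ((p ∸ 1) C 2) ≡ (p * (n C 2)) * (((p ∸ 1) C 2) * n ^ 2)
  regroupII = regroup p (n ^ 2) (n C 2) ((p ∸ 1) C 2)

  countII : Fin (p * n ^ 2 * (n C 2) * ((p ∸ 1) C 2)) ↔ FacetII p (pred N)
  countII = begin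
    Fin (p * n ^ 2 * (n C 2) * ((p ∸ 1) C 2))               ≡⟨ cong Fin regroupII ⟩
    Fin ((p * (n C 2)) * (((p ∸ 1) C 2) * n ^ 2))
      ↔⟨ (Fin↔Below p ⊗ count2 n) ⊗ (count2 (pred p) ⊗ Fin^↔Tuple (Fin↔Below n) 2) ⟩
    ((Below p × Subset2 n) × (Subset2 (pred p) × Tuple (Below n) 2))
      ↔⟨ congPair↔ ×-↔ ↔-id _ ⟨
    (CongPair × (Subset2 (pred p) × Tuple (Below n) 2))
      ↔⟨ Σ-↔ (↔-id CongPair) (λ {c} → digitsII (res (lo c)) (res< (lo c))) ⟨
    Σ CongPair (λ c → Inc2 res id (Avoid (res (lo c))))
      ↔⟨ Σ-↔ (↔-id CongPair) (λ {c} → resort2 id res (Avoid (res (lo c)))) ⟨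
    Σ CongPair (λ c → Inc2 id res (Avoid (res (lo c))))     ↔⟨ typeII↔Σ ⟨
    FacetII p (pred N)                                       ∎
    where open EquationalReasoning

^-distribʳ-* : ∀ k m e → (k * m) ^ e ≡ k ^ e * m ^ e
^-distribʳ-* k m zero    = refl
^-distribʳ-* k m (suc e) = trans (cong ((k * m) *_) (^-distribʳ-* k m e)) ([m*n]*[o*p]≡[m*o]*[n*p] k m (k ^ e) (m ^ e))

-- For m ≥ 1, (m+1)³ + 2(m+1)⁴ ≤ 3(m+1)⁴ ≤ 3(2m)⁴ = 48m⁴.
quartic-bound : ∀ m → 1 ≤ m → suc m ^ 3 + (suc m ^ 4 + suc m ^ 4) ≤ 48 * m ^ 4
quartic-bound m 1≤m = begin
  suc m ^ 3 + (suc m ^ 4 + suc m ^ 4)  ≤⟨ +-monoˡ-≤ (suc m ^ 4 + suc m ^ 4) (m≤n*m (suc m ^ 3) (suc m)) ⟩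
  suc m ^ 4 + (suc m ^ 4 + suc m ^ 4)  ≡⟨ cong (λ x → suc m ^ 4 + (suc m ^ 4 + x)) (+-identityʳ (suc m ^ 4)) ⟨
  3 * suc m ^ 4                        ≤⟨ *-monoʳ-≤ 3 (^-monoˡ-≤ 4 m+1≤2m) ⟩
  3 * (2 * m) ^ 4                      ≡⟨ cong (3 *_) (^-distribʳ-* 2 m 4) ⟩
  3 * (16 * m ^ 4)                     ≡⟨ *-assoc 3 16 (m ^ 4) ⟨
  48 * m ^ 4                           ∎
  where
  open ≤-Reasoning
  m+1≤2m : suc m ≤ 2 * m
  m+1≤2m = subst (suc m ≤_) (cong (m +_) (sym (+-identityʳ m))) (+-monoˡ-≤ m 1≤m)

count-mono : ∀ {N K} {A B : Set} → Fin N ↔ A → Fin K ↔ B →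
  (f : A → B) → (∀ {x y} → f x ≡ f y → x ≡ y) → N ≤ K
count-mono {A = A} {B} A↔ B↔ f f-inj =
  injective⇒≤ {f = Inverse.from B↔ ∘ f ∘ Inverse.to A↔}
    (λ e → Injection.injective (↔⇒↣ A↔) (f-inj (Injection.injective (↔⇒↣ (↔-sym B↔)) e)))

-- Forgetting the conditions, a facet of H_{p,m} is determined by its type and
-- its three or four indices in {0,…,m}.
module FacetIndices (p m : ℕ) where

  Indices : Set
  Indices = Tuple (Below (suc m)) 3 ⊎ (Tuple (Below (suc m)) 4 ⊎ Tuple (Below (suc m)) 4)

  countIndices : Fin (suc m ^ 3 + (suc m ^ 4 + suc m ^ 4)) ↔ Indices
  countIndices = tuples 3 ⊕ tuples 4 ⊕ tuples 4
    where
    tuples : ∀ k → Fin (suc m ^ k) ↔ Tuple (Below (suc m)) k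
    tuples = Fin^↔Tuple (Fin↔Below (suc m))

  index : ∀ {x y} → .(x < y) → .(y ≤ m) → Below (suc m)
  index {x} x<y y≤m = below x (s≤s (≤-trans (<⇒≤ x<y) y≤m))

  indices : Facet p m → Indices
  indices (inj₁ (typeI i j k i<j j<k k≤m _ _ _)) =
    inj₁ (index (<-trans i<j j<k) k≤m , index j<k k≤m , below k (s≤s k≤m) , tt)
  indices (inj₂ (inj₁ (typeII i j k l i<j j≤m k<l l≤m _ _ _ _))) =
    inj₂ (inj₁ (index i<j j≤m , below j (s≤s j≤m) , index k<l l≤m , below l (s≤s l≤m) , tt))
  indices (inj₂ (inj₂ (typeIII i j k l i<j j≤m k<l l≤m _ _ _ _))) =
    inj₂ (inj₂ (index i<j j≤m , below j (s≤s j≤m) , index k<l l≤m , below l (s≤s l≤m) , tt))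

  -- Distinct facets have distinct indices (the conditions are irrelevant).
  indices-injective : ∀ {f g} → indices f ≡ indices g → f ≡ g
  indices-injective {inj₁ (typeI _ _ _ _ _ _ _ _ _)} {inj₁ (typeI _ _ _ _ _ _ _ _ _)} refl = refl
  indices-injective {inj₂ (inj₁ (typeII _ _ _ _ _ _ _ _ _ _ _ _))}
                    {inj₂ (inj₁ (typeII _ _ _ _ _ _ _ _ _ _ _ _))} refl = refl
  indices-injective {inj₂ (inj₂ (typeIII _ _ _ _ _ _ _ _ _ _ _ _))}
                    {inj₂ (inj₂ (typeIII _ _ _ _ _ _ _ _ _ _ _ _))} refl = refl
  indices-injective {inj₁ _}        {inj₂ (inj₁ _)} ()
  indices-injective {inj₁ _}        {inj₂ (inj₂ _)} ()
  indices-injective {inj₂ (inj₁ _)} {inj₁ _}        ()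
  indices-injective {inj₂ (inj₁ _)} {inj₂ (inj₂ _)} ()
  indices-injective {inj₂ (inj₂ _)} {inj₁ _}        ()
  indices-injective {inj₂ (inj₂ _)} {inj₂ (inj₁ _)} ()

  facets≤ : ∀ N → Fin N ↔ Facet p m → N ≤ suc m ^ 3 + (suc m ^ 4 + suc m ^ 4)
  facets≤ N counted = count-mono counted countIndices indices indices-injective

mainTheorem7 : (p : ℕ) → Prime p → 2 < p →
    ((n : ℕ) → 1 ≤ n →
        (Fin ((p C 3) * n ^ 3) ↔ FacetI p (p * n ∸ 1))
      × (Fin (p * n ^ 2 * (n C 2) * ((p ∸ 1) C 2)) ↔ FacetII p (p * n ∸ 1))
      × (Fin ((p C 2) * (n C 2) ^ 2) ↔ FacetIII p (p * n ∸ 1)))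
    × ∃ λ (C : ℕ) → (m : ℕ) → 1 ≤ m → (N : ℕ) → (Fin N ↔ Facet p m) → N ≤ C * m ^ 4
mainTheorem7 p _ 2<p = counts , 48 , bound
  where
  instance
    p≢0 : NonZero p
    p≢0 = >-nonZero (<-trans z<s 2<p)
  counts : (n : ℕ) → 1 ≤ n →
      (Fin ((p C 3) * n ^ 3) ↔ FacetI p (p * n ∸ 1))
    × (Fin (p * n ^ 2 * (n C 2) * ((p ∸ 1) C 2)) ↔ FacetII p (p * n ∸ 1))
    × (Fin ((p C 2) * (n C 2) ^ 2) ↔ FacetIII p (p * n ∸ 1))
  counts n 1≤n = countI , countII , countIII
    where
    instance
      n≢0 : NonZero n
      n≢0 = >-nonZero 1≤n
    open Facets p n
  bound : (m : ℕ) → 1 ≤ m → (N : ℕ) → (Fin N ↔ Facet p m) → N ≤ 48 * m ^ 4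
  bound m 1≤m N counted = ≤-trans (FacetIndices.facets≤ p m N counted) (quartic-bound m 1≤m)
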